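{- Let $G=(V,E)$ be a graph and $x,a,b\in V$ with $xa\in E$, $xb\in E$ and $ab\notin E$. Let $w$ be a word representing $G$ in which each letter appears at most twice. If there is an occurrence of $x$ in $w$ such that each of $a$ and $b$ occurs both before and after that occurrence, then the relative order of $a$ and $b$ before that occurrence of $x$ is the opposite of their relative order after it.
   Context: A word is a finite sequence of letters. Two letters $x,y$ alternate in a word $w$ if between any two occurrences of $x$ there is an occurrence of $y$ and between any two occurrences of $y$ there is an occurrence of $x$. A graph $G=(V,E)$ is represented by a word $w$ over $V$ if for all distinct $x,y\in V$, $x$ and $y$ alternate in $w$ if and only if $xy\in E$. -}

module Defs where

open import Data.Nat using (ℕ; _≤_)
open import Data.Fin using (Fin; _<_; _≟_)
open import Data.List using (List; length; lookup; filter)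
open import Data.Product using (Σ; _×_; _,_)
open import Relation.Binary.PropositionalEquality using (_≡_)
open import Relation.Nullary using (¬_)
open import Function.Bundles using (_⇔_)

record Graph (n : ℕ) : Set₁ where
  field
    E      : Fin n → Fin n → Set
    E-sym  : ∀ {x y} → E x y → E y x
    E-irr  : ∀ {x} → ¬ E x x
open Graph public

Word : ℕ → Set
Word n = List (Fin n)

Pos : ∀ {n} → Word n → Set
Pos w = Fin (length w)

_at_≡_ : ∀ {n} (w : Word n) → Pos w → Fin n → Set
w at i ≡ x = lookup w i ≡ x

Separates : ∀ {n} → Word n → Fin n → Fin n → Set
Separates w x y = ∀ (i j : Pos w) → w at i ≡ x → w at j ≡ x → i < j →
  Σ (Pos w) λ k → (i < k) × (k < j) × (w at k ≡ y)

Alternate : ∀ {n} → Word n → Fin n → Fin n → Set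
Alternate w x y = Separates w x y × Separates w y x

Represents : ∀ {n} → Word n → Graph n → Set
Represents w G = ∀ x y → ¬ x ≡ y → (Alternate w x y ⇔ E G x y)

AtMostTwice : ∀ {n} → Word n → Set
AtMostTwice w = ∀ x → length (filter (_≟ x) w) ≤ 2

module Submission where

-- The heart of the matter is: if a and b are non-adjacent and each occurs at
-- most twice, then w contains no subsequence  a b a b.  Indeed, in such a
-- pattern the two occurrences of a are the only ones and b sits between them,
-- and symmetrically for b, so a and b alternate — which would make ab an edge.
-- (If a ≡ b the pattern already gives three occurrences of one letter.)
--
-- The theorem is that fact applied to (a , b)
-- and, by symmetry of E, to (b , a).

open import Defs
open import Data.Nat using (ℕ; suc; s≤s; z≤n) renaming (_≤_ to _≤ℕ_)
import Data.Nat.Properties as ℕ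
open import Data.Fin using (Fin; _<_; _≟_) renaming (zero to fzero; suc to fsuc)
open import Data.Fin.Properties using (<-cmp; <-trans; <-irrefl; <-asym)
open import Data.List using (_∷_; length; filter)
open import Data.List.Properties using (filter-accept)
open import Data.Product using (_×_; _,_)
open import Data.Sum using (_⊎_; inj₁; inj₂)
open import Data.Empty using (⊥; ⊥-elim)
open import Relation.Nullary using (¬_; yes; no)
open import Relation.Binary.PropositionalEquality using (_≡_; refl; sym; trans)
open import Relation.Binary.Definitions using (tri<; tri≈; tri>)
open import Function.Bundles using (Equivalence)

module Occurrences {n : ℕ} (a : Fin n) where

  count : Word n → ℕ
  count w = length (filter (_≟ a) w)

  count-cons : ∀ y (w : Word n) → count w ≤ℕ count (y ∷ w)
  count-cons y w with y ≟ a
  ... | yes _ = ℕ.n≤1+n _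
  ... | no _  = ℕ.≤-refl

  count-head : ∀ (w : Word n) → count (a ∷ w) ≡ suc (count w)
  count-head w rewrite filter-accept (_≟ a) {a} {w} refl = refl

  count≥1 : ∀ (w : Word n) (i : Pos w) → w at i ≡ a → 1 ≤ℕ count w
  count≥1 (y ∷ w) fzero    refl rewrite count-head w = s≤s z≤n
  count≥1 (y ∷ w) (fsuc i) ei   = ℕ.≤-trans (count≥1 w i ei) (count-cons y w)

  count≥2 : ∀ (w : Word n) (i j : Pos w) → i < j →
    w at i ≡ a → w at j ≡ a → 2 ≤ℕ count w
  count≥2 (y ∷ w) fzero (fsuc j) _ refl ej rewrite count-head w = s≤s (count≥1 w j ej)
  count≥2 (y ∷ w) (fsuc i) (fsuc j) (s≤s i<j) ei ej =
    ℕ.≤-trans (count≥2 w i j i<j ei ej) (count-cons y w)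

  count≥3 : ∀ (w : Word n) (i j k : Pos w) → i < j → j < k →
    w at i ≡ a → w at j ≡ a → w at k ≡ a → 3 ≤ℕ count w
  count≥3 (y ∷ w) fzero (fsuc j) (fsuc k) _ (s≤s j<k) refl ej ek
    rewrite count-head w = s≤s (count≥2 w j k j<k ej ek)
  count≥3 (y ∷ w) (fsuc i) (fsuc j) (fsuc k) (s≤s i<j) (s≤s j<k) ei ej ek =
    ℕ.≤-trans (count≥3 w i j k i<j j<k ei ej ek) (count-cons y w)

  no-third-occurrence : ∀ (w : Word n) → AtMostTwice w → (i j k : Pos w) →
    i < j → j < k → w at i ≡ a → w at j ≡ a → w at k ≡ a → ⊥
  no-third-occurrence w twice i j k i<j j<k ei ej ek =
    ℕ.<-irrefl refl (ℕ.≤-trans (count≥3 w i j k i<j j<k ei ej ek) (twice a))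

  only-occurrences : ∀ (w : Word n) → AtMostTwice w → (i k u : Pos w) → i < k →
    w at i ≡ a → w at k ≡ a → w at u ≡ a → u ≡ i ⊎ u ≡ k
  only-occurrences w twice i k u i<k ei ek eu with <-cmp u i
  ... | tri< u<i _ _ = ⊥-elim (no-third-occurrence w twice u i k u<i i<k eu ei ek)
  ... | tri≈ _ u≡i _ = inj₁ u≡i
  ... | tri> _ _ i<u with <-cmp u k
  ...   | tri< u<k _ _ = ⊥-elim (no-third-occurrence w twice i u k i<u u<k ei eu ek)
  ...   | tri≈ _ u≡k _ = inj₂ u≡k
  ...   | tri> _ _ k<u = ⊥-elim (no-third-occurrence w twice i k u i<k k<u ei ek eu)

open Occurrences using (no-third-occurrence; only-occurrences)

-- If a occurs at most twice and b occurs between two occurrences of a,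
-- then b separates a: the only pair of a-occurrences to check is (i , k).
separates-from-middle : ∀ {n} (w : Word n) → AtMostTwice w → (a b : Fin n) (i m k : Pos w) →
  i < m → m < k → w at i ≡ a → w at m ≡ b → w at k ≡ a → Separates w a b
separates-from-middle w twice a b i m k i<m m<k ei em ek u v eu ev u<v
  with only-occurrences a w twice i k u i<k ei ek eu
     | only-occurrences a w twice i k v i<k ei ek ev
  where i<k = <-trans i<m m<k
... | inj₁ refl | inj₁ refl = ⊥-elim (<-irrefl refl u<v)
... | inj₁ refl | inj₂ refl = m , i<m , m<k , em
... | inj₂ refl | inj₁ refl = ⊥-elim (<-asym u<v (<-trans i<m m<k))
... | inj₂ refl | inj₂ refl = ⊥-elim (<-irrefl refl u<v)

-- A word representing G, with every letter at most twice, contains no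
-- subsequence  a b a b  for non-adjacent a, b: the pattern forces alternation.
no-abab : ∀ {n} (G : Graph n) (a b : Fin n) → ¬ E G a b →
  (w : Word n) → Represents w G → AtMostTwice w →
  (i j k l : Pos w) → i < j → j < k → k < l →
  w at i ≡ a → w at j ≡ b → w at k ≡ a → w at l ≡ b → ⊥
no-abab G a b ¬ab w rep twice i j k l i<j j<k k<l ei ej ek el with a ≟ b
... | yes refl = no-third-occurrence a w twice i j k i<j j<k ei ej ek
... | no a≢b   = ¬ab (Equivalence.to (rep a b a≢b) alternate)
  where
  alternate : Alternate w a b
  alternate = separates-from-middle w twice a b i j k i<j j<k ei ej ek
            , separates-from-middle w twice b a j k l j<k k<l ej ek el

-- If a precedes b before some point (i < j < k) and both occur again later
-- (a at k, b at l), then b now precedes a.  The case k ≡ l would make a ≡ b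
-- occur three times.
order-reverses : ∀ {n} (G : Graph n) (a b : Fin n) → ¬ E G a b →
  (w : Word n) → Represents w G → AtMostTwice w →
  (i j k l : Pos w) → i < j → j < k →
  w at i ≡ a → w at j ≡ b → w at k ≡ a → w at l ≡ b → l < k
order-reverses G a b ¬ab w rep twice i j k l i<j j<k ei ej ek el with <-cmp k l
... | tri< k<l _ _ = ⊥-elim (no-abab G a b ¬ab w rep twice i j k l i<j j<k k<l ei ej ek el)
... | tri≈ _ refl _ =
  ⊥-elim (no-third-occurrence a w twice i j k i<j j<k ei (trans ej (trans (sym el) ek)) ek)
... | tri> _ _ l<k = l<k

lemma3p6 : ∀ {n} (G : Graph n) (x a b : Fin n) →
    E G x a → E G x b → ¬ E G a b →
    (w : Word n) → Represents w G → AtMostTwice w →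
    (p : Pos w) → w at p ≡ x →
    (i j k l : Pos w) →
    i < p → w at i ≡ a → j < p → w at j ≡ b →
    p < k → w at k ≡ a → p < l → w at l ≡ b →
    (i < j → l < k) × (j < i → k < l)
lemma3p6 G x a b _ _ ¬ab w rep twice p _ i j k l i<p ei j<p ej p<k ek p<l el =
    (λ i<j → order-reverses G a b ¬ab w rep twice i j k l i<j (<-trans j<p p<k) ei ej ek el)
  , (λ j<i → order-reverses G b a ¬ba w rep twice j i l k j<i (<-trans i<p p<l) ej ei el ek)
  where
  ¬ba : ¬ E G b a
  ¬ba ba = ¬ab (E-sym G ba)
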